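{- For every $n\ge1$: $2r_n\in C(2r_{n+1})$, $4r_n\in C(4r_{n+1})$, $2t_n\in C(2t_{n+1})$, $2s_n\in C(2s_{n+1})$, $2p_n\in C(2p_{n+1})$, $2q_n\in C(2q_{n+1})$, $2u_n\in C(2u_{n+1})$ and $2w_n\in C(2w_{n+1})$. For every $n\ge2$, $2v_n\in C(2v_{n+1})$.
   Context: Arithmetic is in $\mathbb{Z}_8$. For an operation $g$, $C(g)$ denotes the clone on $\mathbb{Z}_8$ generated by $g$, the binary addition and all unary constant operations. Polynomials: $r_n=x_1\cdots x_n$; $t_n=x_1\cdots x_n(x_1+\dots+x_n)$ for $n$ even and $x_1\cdots x_n(x_1+\dots+x_n+1)$ for $n$ odd; $s_n=x_1\cdots x_n(x_1+\dots+x_n)$ for $n$ odd and $x_1\cdots x_n(x_1+\dots+x_n+1)$ for $n$ even; $p_n=x_1^2x_2\cdots x_n$; $q_n=x_1^3x_2\cdots x_n$; $w_n=x_1\cdots x_n(x_1^2+1)$; $u_n=x_1\cdots x_n(x_1+1)$; $v_n=x_1\cdots x_n(x_1+x_2)$ ($n\ge2$). -}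

module Defs where

open import Data.Nat using (ℕ; zero; suc; _+_; _*_)
open import Data.Nat.DivMod using (_mod_)
open import Data.Fin using (Fin; toℕ) renaming (zero to fz; suc to fs)
open import Data.Product using (Σ)
open import Data.Bool using (Bool; true; false; if_then_else_; not)
open import Relation.Binary.PropositionalEquality using (_≡_)

ℤ₈ : Set
ℤ₈ = Fin 8

ι : ℕ → ℤ₈
ι n = n mod 8

infixl 6 _⊕_
infixl 7 _⊗_
_⊕_ : ℤ₈ → ℤ₈ → ℤ₈
a ⊕ b = (toℕ a + toℕ b) mod 8

_⊗_ : ℤ₈ → ℤ₈ → ℤ₈
a ⊗ b = (toℕ a * toℕ b) mod 8

Op : ℕ → Set
Op n = (Fin n → ℤ₈) → ℤ₈

data Term (m n : ℕ) : Set where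
  var   : Fin n → Term m n
  const : ℤ₈ → Term m n
  add   : Term m n → Term m n → Term m n
  app   : (Fin m → Term m n) → Term m n

eval : ∀ {m n} → Op m → Term m n → Op n
eval g (var i)   ρ = ρ i
eval g (const c) ρ = c
eval g (add s t) ρ = eval g s ρ ⊕ eval g t ρ
eval g (app ts)  ρ = g (λ i → eval g (ts i) ρ)

-- f ∈ C(g): the clone generated by g, + and all constants consists exactly of
-- the term operations above.
_∈C_ : ∀ {n m} → Op n → Op m → Set
_∈C_ {n} {m} f g = Σ (Term m n) (λ t → ∀ ρ → eval g t ρ ≡ f ρ)

ΣF : ∀ {n} → (Fin n → ℤ₈) → ℤ₈
ΣF {zero}  f = ι 0
ΣF {suc n} f = f fz ⊕ ΣF (λ i → f (fs i))

ΠF : ∀ {n} → (Fin n → ℤ₈) → ℤ₈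
ΠF {zero}  f = ι 1
ΠF {suc n} f = f fz ⊗ ΠF (λ i → f (fs i))

isEven : ℕ → Bool
isEven zero    = true
isEven (suc n) = not (isEven n)

_·_ : ∀ {n} → ℤ₈ → Op n → Op n
(c · f) ρ = c ⊗ f ρ

-- The polynomials (x₁ is index 0, x₂ is index 1).
r : (n : ℕ) → Op n
r n ρ = ΠF ρ

t : (n : ℕ) → Op n
t n ρ = ΠF ρ ⊗ (if isEven n then ΣF ρ else ΣF ρ ⊕ ι 1)

s : (n : ℕ) → Op n
s n ρ = ΠF ρ ⊗ (if isEven n then ΣF ρ ⊕ ι 1 else ΣF ρ)

-- the following need n ≥ 1; given with arity suc k
p : (k : ℕ) → Op (suc k)
p k ρ = ρ fz ⊗ ρ fz ⊗ ΠF (λ i → ρ (fs i))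

q : (k : ℕ) → Op (suc k)
q k ρ = ρ fz ⊗ ρ fz ⊗ ρ fz ⊗ ΠF (λ i → ρ (fs i))

w : (k : ℕ) → Op (suc k)
w k ρ = ΠF ρ ⊗ (ρ fz ⊗ ρ fz ⊕ ι 1)

u : (k : ℕ) → Op (suc k)
u k ρ = ΠF ρ ⊗ (ρ fz ⊕ ι 1)

-- v needs n ≥ 2; given with arity suc (suc k)
v : (k : ℕ) → Op (suc (suc k))
v k ρ = ΠF ρ ⊗ (ρ fz ⊕ ρ (fs fz))

{-# OPTIONS --safe #-}
module Submission where

-- Each polynomial of arity n arises from the one of arity n + 1 by fixing a
-- variable to a constant: x₁ := 1 for r, x₂ := 1 for p, q, u, w and x₃ := 1
-- for v.  For t and s, whether x₁ + ⋯ + xₙ carries a summand + 1 alternates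
-- with the parity of n; fixing x₁ := c with c ∈ {1, −1} shifts the sum by c and
-- puts a factor c in front, which is removed by multiplying with c again
-- (c² = 1; multiplication by a constant is repeated addition in the clone).
-- None of this depends on the scalar factor in front.

open import Defs
open import Algebra.Bundles using (RawMonoid)
open import Data.Bool using (Bool; true; false; if_then_else_; not)
open import Data.Fin using (Fin; toℕ; _≟_) renaming (zero to fz; suc to fs)
open import Data.Fin.Properties using (all?)
open import Data.Nat using (ℕ; zero; suc)
open import Data.Product using (_×_; _,_)
open import Data.Vec.Functional using (Vector; insertAt; tail)
open import Function using (_∘_)
open import Level using (0ℓ)
open import Relation.Nullary.Decidable using (from-yes)
open import Relation.Binary.PropositionalEquality
  using (_≡_; _≗_; refl; sym; trans; cong; cong₂; module ≡-Reasoning)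
open ≡-Reasoning

+-rawMonoid : RawMonoid 0ℓ 0ℓ
+-rawMonoid = record { Carrier = ℤ₈ ; _≈_ = _≡_ ; _∙_ = _⊕_ ; ε = ι 0 }

open import Algebra.Definitions.RawMonoid +-rawMonoid using () renaming (_×_ to _×⊕_)

⊕-comm : ∀ a b → a ⊕ b ≡ b ⊕ a
⊕-comm = from-yes (all? λ a → all? λ b → a ⊕ b ≟ b ⊕ a)

⊗-comm : ∀ a b → a ⊗ b ≡ b ⊗ a
⊗-comm = from-yes (all? λ a → all? λ b → a ⊗ b ≟ b ⊗ a)

⊗-assoc : ∀ a b c → (a ⊗ b) ⊗ c ≡ a ⊗ (b ⊗ c)
⊗-assoc = from-yes (all? λ a → all? λ b → all? λ c → (a ⊗ b) ⊗ c ≟ a ⊗ (b ⊗ c))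

⊗-identityˡ : ∀ a → ι 1 ⊗ a ≡ a
⊗-identityˡ = from-yes (all? λ a → ι 1 ⊗ a ≟ a)

×⊕-toℕ : ∀ c a → toℕ c ×⊕ a ≡ c ⊗ a
×⊕-toℕ = from-yes (all? λ c → all? λ a → toℕ c ×⊕ a ≟ c ⊗ a)

7⊕a⊕1≡a : ∀ a → (ι 7 ⊕ a) ⊕ ι 1 ≡ a
7⊕a⊕1≡a = from-yes (all? λ a → (ι 7 ⊕ a) ⊕ ι 1 ≟ a)

⊗-leftComm : ∀ a b c → a ⊗ (b ⊗ c) ≡ b ⊗ (a ⊗ c)
⊗-leftComm a b c = begin
  a ⊗ (b ⊗ c)  ≡⟨ sym (⊗-assoc a b c) ⟩
  (a ⊗ b) ⊗ c  ≡⟨ cong (_⊗ c) (⊗-comm a b) ⟩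
  (b ⊗ a) ⊗ c  ≡⟨ ⊗-assoc b a c ⟩
  b ⊗ (a ⊗ c)  ∎

unit-cancel : ∀ {c} → c ⊗ c ≡ ι 1 → ∀ a b → c ⊗ ((c ⊗ a) ⊗ b) ≡ a ⊗ b
unit-cancel {c} c²≡1 a b = begin
  c ⊗ ((c ⊗ a) ⊗ b)  ≡⟨ cong (c ⊗_) (⊗-assoc c a b) ⟩
  c ⊗ (c ⊗ (a ⊗ b))  ≡⟨ sym (⊗-assoc c c (a ⊗ b)) ⟩
  (c ⊗ c) ⊗ (a ⊗ b)  ≡⟨ cong (_⊗ (a ⊗ b)) c²≡1 ⟩
  ι 1 ⊗ (a ⊗ b)      ≡⟨ ⊗-identityˡ (a ⊗ b) ⟩
  a ⊗ b              ∎

Congruent : ∀ {n} → Op n → Set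
Congruent g = ∀ {ρ σ} → ρ ≗ σ → g ρ ≡ g σ

ΠF-cong : ∀ {n} → Congruent (ΠF {n})
ΠF-cong {zero}  e = refl
ΠF-cong {suc n} e = cong₂ _⊗_ (e fz) (ΠF-cong (e ∘ fs))

ΣF-cong : ∀ {n} → Congruent (ΣF {n})
ΣF-cong {zero}  e = refl
ΣF-cong {suc n} e = cong₂ _⊕_ (e fz) (ΣF-cong (e ∘ fs))

·-cong : ∀ {n} {g : Op n} d → Congruent g → Congruent (d · g)
·-cong d g-cong = cong (d ⊗_) ∘ g-cong

∈C-resp : ∀ {n m} {f f′ : Op n} {g : Op m} → f ≗ f′ → f ∈C g → f′ ∈C g
∈C-resp f≗f′ (T , T≗f) = T , λ ρ → trans (T≗f ρ) (f≗f′ ρ)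

infixr 8 _×ₜ_
_×ₜ_ : ∀ {m n} → ℕ → Term m n → Term m n
zero  ×ₜ T = const (ι 0)
suc k ×ₜ T = add T (k ×ₜ T)

eval-×ₜ : ∀ {m n} (g : Op m) k (T : Term m n) ρ → eval g (k ×ₜ T) ρ ≡ k ×⊕ eval g T ρ
eval-×ₜ g zero    T ρ = refl
eval-×ₜ g (suc k) T ρ = cong (eval g T ρ ⊕_) (eval-×ₜ g k T ρ)

·-∈C : ∀ {n m} {f : Op n} {g : Op m} c → f ∈C g → (c · f) ∈C g
·-∈C {f = f} {g} c (T , T≗f) = toℕ c ×ₜ T , λ ρ → begin
  eval g (toℕ c ×ₜ T) ρ  ≡⟨ eval-×ₜ g (toℕ c) T ρ ⟩
  toℕ c ×⊕ eval g T ρ    ≡⟨ ×⊕-toℕ c (eval g T ρ) ⟩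
  c ⊗ eval g T ρ         ≡⟨ cong (c ⊗_) (T≗f ρ) ⟩
  c ⊗ f ρ                ∎

_[_≔_] : ∀ {m} → Op (suc m) → Fin (suc m) → ℤ₈ → Op m
(g [ i ≔ c ]) ρ = g (insertAt ρ i c)

map-insertAt : ∀ {A B : Set} {n} (f : A → B) (xs : Vector A n) i v →
               f ∘ insertAt xs i v ≗ insertAt (f ∘ xs) i (f v)
map-insertAt             f xs fz     v fz     = refl
map-insertAt             f xs fz     v (fs j) = refl
map-insertAt {n = suc n} f xs (fs i) v fz     = refl
map-insertAt {n = suc n} f xs (fs i) v (fs j) = map-insertAt f (tail xs) i v j

fix-∈C : ∀ {m} {g : Op (suc m)} {i c} → Congruent g → (g [ i ≔ c ]) ∈C g
fix-∈C {g = g} {i} {c} g-cong =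
  app (insertAt var i (const c)) , λ ρ → g-cong (map-insertAt (λ T → eval g T ρ) var i (const c))

fix₁-∈C : ∀ {m} {f : Op m} {g : Op (suc m)} d i → Congruent g →
          g [ i ≔ ι 1 ] ≗ f → (d · f) ∈C (d · g)
fix₁-∈C d i g-cong fixed = ∈C-resp (cong (d ⊗_) ∘ fixed) (fix-∈C {i = i} {ι 1} (·-cong d g-cong))

prodTimes : (ℤ₈ → ℤ₈) → (n : ℕ) → Op n
prodTimes h n ρ = ΠF ρ ⊗ h (ΣF ρ)

prodTimes-cong : ∀ {h n} → Congruent (prodTimes h n)
prodTimes-cong {h} e = cong₂ _⊗_ (ΠF-cong e) (cong h (ΣF-cong e))

prodTimes-shift : ∀ (h h′ : ℤ₈ → ℤ₈) n d c → c ⊗ c ≡ ι 1 → (∀ a → h (c ⊕ a) ≡ h′ a) →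
                  (d · prodTimes h′ n) ∈C (d · prodTimes h (suc n))
prodTimes-shift h h′ n d c c²≡1 shift =
  ∈C-resp fixed (·-∈C c (fix-∈C {i = fz} {c} (·-cong d (prodTimes-cong {h} {suc n}))))
  where
  fixed : ∀ ρ → c ⊗ (d ⊗ ((c ⊗ ΠF ρ) ⊗ h (c ⊕ ΣF ρ))) ≡ d ⊗ (ΠF ρ ⊗ h′ (ΣF ρ))
  fixed ρ = begin
    c ⊗ (d ⊗ ((c ⊗ ΠF ρ) ⊗ h (c ⊕ ΣF ρ)))  ≡⟨ ⊗-leftComm c d _ ⟩
    d ⊗ (c ⊗ ((c ⊗ ΠF ρ) ⊗ h (c ⊕ ΣF ρ)))  ≡⟨ cong (d ⊗_) (unit-cancel {c} c²≡1 (ΠF ρ) _) ⟩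
    d ⊗ (ΠF ρ ⊗ h (c ⊕ ΣF ρ))              ≡⟨ cong (λ x → d ⊗ (ΠF ρ ⊗ x)) (shift (ΣF ρ)) ⟩
    d ⊗ (ΠF ρ ⊗ h′ (ΣF ρ))                 ∎

plusOneUnless : Bool → ℤ₈ → ℤ₈
plusOneUnless b a = if b then a else a ⊕ ι 1

plusOneIf : Bool → ℤ₈ → ℤ₈
plusOneIf b a = if b then a ⊕ ι 1 else a

plusOneUnless-∈C : ∀ d n b →
  (d · prodTimes (plusOneUnless b) n) ∈C (d · prodTimes (plusOneUnless (not b)) (suc n))
plusOneUnless-∈C d n true  =
  prodTimes-shift (plusOneUnless false) (plusOneUnless true) n d (ι 7) refl 7⊕a⊕1≡a
plusOneUnless-∈C d n false =
  prodTimes-shift (plusOneUnless true) (plusOneUnless false) n d (ι 1) refl (⊕-comm (ι 1))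

plusOneIf-∈C : ∀ d n b →
  (d · prodTimes (plusOneIf b) n) ∈C (d · prodTimes (plusOneIf (not b)) (suc n))
plusOneIf-∈C d n true  =
  prodTimes-shift (plusOneIf false) (plusOneIf true) n d (ι 1) refl (⊕-comm (ι 1))
plusOneIf-∈C d n false =
  prodTimes-shift (plusOneIf true) (plusOneIf false) n d (ι 7) refl 7⊕a⊕1≡a

-- t n unfolds to prodTimes (plusOneUnless (isEven n)) n and s n to
-- prodTimes (plusOneIf (isEven n)) n, while isEven (suc n) unfolds to not (isEven n).
t-∈C : ∀ d n → (d · t n) ∈C (d · t (suc n))
t-∈C d n = plusOneUnless-∈C d n (isEven n)

s-∈C : ∀ d n → (d · s n) ∈C (d · s (suc n))
s-∈C d n = plusOneIf-∈C d n (isEven n)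

r-∈C : ∀ d n → (d · r n) ∈C (d · r (suc n))
r-∈C d n = fix₁-∈C d fz ΠF-cong (⊗-identityˡ ∘ ΠF)

p-∈C : ∀ d k → (d · p k) ∈C (d · p (suc k))
p-∈C d k = fix₁-∈C d (fs fz) p-cong λ ρ → cong (ρ fz ⊗ ρ fz ⊗_) (⊗-identityˡ _)
  where
  p-cong : Congruent (p (suc k))
  p-cong e = cong₂ _⊗_ (cong₂ _⊗_ (e fz) (e fz)) (ΠF-cong (e ∘ fs))

q-∈C : ∀ d k → (d · q k) ∈C (d · q (suc k))
q-∈C d k = fix₁-∈C d (fs fz) q-cong λ ρ → cong (ρ fz ⊗ ρ fz ⊗ ρ fz ⊗_) (⊗-identityˡ _)
  where
  q-cong : Congruent (q (suc k))
  q-cong e = cong₂ _⊗_ (cong₂ _⊗_ (cong₂ _⊗_ (e fz) (e fz)) (e fz)) (ΠF-cong (e ∘ fs))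

u-∈C : ∀ d k → (d · u k) ∈C (d · u (suc k))
u-∈C d k = fix₁-∈C d (fs fz) u-cong λ ρ →
  cong (λ a → (ρ fz ⊗ a) ⊗ (ρ fz ⊕ ι 1)) (⊗-identityˡ _)
  where
  u-cong : Congruent (u (suc k))
  u-cong e = cong₂ _⊗_ (ΠF-cong e) (cong (_⊕ ι 1) (e fz))

w-∈C : ∀ d k → (d · w k) ∈C (d · w (suc k))
w-∈C d k = fix₁-∈C d (fs fz) w-cong λ ρ →
  cong (λ a → (ρ fz ⊗ a) ⊗ (ρ fz ⊗ ρ fz ⊕ ι 1)) (⊗-identityˡ _)
  where
  w-cong : Congruent (w (suc k))
  w-cong e = cong₂ _⊗_ (ΠF-cong e) (cong (_⊕ ι 1) (cong₂ _⊗_ (e fz) (e fz)))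

v-∈C : ∀ d k → (d · v k) ∈C (d · v (suc k))
v-∈C d k = fix₁-∈C d (fs (fs fz)) v-cong λ ρ →
  cong (λ a → (ρ fz ⊗ (ρ (fs fz) ⊗ a)) ⊗ (ρ fz ⊕ ρ (fs fz))) (⊗-identityˡ _)
  where
  v-cong : Congruent (v (suc k))
  v-cong e = cong₂ _⊗_ (ΠF-cong e) (cong₂ _⊕_ (e fz) (e (fs fz)))

lemma4p2 : (∀ (k : ℕ) →
                 (ι 2 · r (suc k)) ∈C (ι 2 · r (suc (suc k)))
               × (ι 4 · r (suc k)) ∈C (ι 4 · r (suc (suc k)))
               × (ι 2 · t (suc k)) ∈C (ι 2 · t (suc (suc k)))
               × (ι 2 · s (suc k)) ∈C (ι 2 · s (suc (suc k)))
               × (ι 2 · p k) ∈C (ι 2 · p (suc k))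
               × (ι 2 · q k) ∈C (ι 2 · q (suc k))
               × (ι 2 · u k) ∈C (ι 2 · u (suc k))
               × (ι 2 · w k) ∈C (ι 2 · w (suc k)))
             × (∀ (k : ℕ) → (ι 2 · v k) ∈C (ι 2 · v (suc k)))
lemma4p2 =
    (λ k → r-∈C (ι 2) (suc k) , r-∈C (ι 4) (suc k) , t-∈C (ι 2) (suc k) , s-∈C (ι 2) (suc k)
         , p-∈C (ι 2) k , q-∈C (ι 2) k , u-∈C (ι 2) k , w-∈C (ι 2) k)
  , v-∈C (ι 2)
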